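{- Let $G$ be a connected graph of order $n\ge 2$. Then $\dim_{1,f}(G)=\frac{n}{2}$ if and only if $G\in H[\mathcal{K}\cup\overline{\mathcal{K}}]$ for some connected graph $H$.
   Context: All graphs are finite, simple, undirected and connected. $d(x,y)$ denotes the distance in $G$. For a positive integer $k$, $d_k(x,y)=\min\{d(x,y),k+1\}$, and for distinct $x,y\in V(G)$, $R_k\{x,y\}=\{z\in V(G): d_k(x,z)\neq d_k(y,z)\}$. For $g$ defined on $V(G)$ and $U\subseteq V(G)$, $g(U)=\sum_{s\in U}g(s)$. A function $h:V(G)\to[0,1]$ is a $k$-truncated resolving function of $G$ if $h(R_k\{x,y\})\ge 1$ for all distinct $x,y\in V(G)$; $\dim_{k,f}(G)=\min\{h(V(G)): h \text{ is a } k\text{ -truncated resolving function of } G\}$, and $\dim_{1,f}$ is the case $k=1$. Let $\mathcal{K}=\{K_a: a\ge 2\}$ (complete graphs) and $\overline{\mathcal{K}}=\{\overline{K}_b: b\ge2\}$ (edgeless graphs). For a connected graph $H$, $H[\mathcal{K}\cup\overline{\mathcal{K}}]$ is the family of graphs obtained from $H$ by replacing each vertex $u_i\in V(H)$ by a graph $H_i\in\mathcal{K}\cup\overline{\mathcal{K}}$, where each vertex of $H_i$ is adjacent to each vertex of $H_j$ ($i\ne j$) if and only if $u_iu_j\in E(H)$.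
   Formalization: The resolving functions $h$ in the definition of $\dim_{1,f}$ take rational values in $[0,1]$. -}

module Defs where

open import Data.Nat using (ℕ; zero; suc; _≥_)
open import Data.Bool using (Bool; true; false; if_then_else_; _∨_; _∧_)
open import Data.Fin using (Fin)
open import Data.Fin.Properties using () renaming (_≟_ to _≟ᶠ_)
open import Data.List using (List; map; foldr; allFin)
open import Data.Bool.ListAction using (any)
open import Data.Product using (Σ; ∃; _×_; _,_)
open import Data.Sum using (_⊎_)
open import Data.Integer using (+_)
open import Data.Rational using (ℚ; 0ℚ; 1ℚ; _+_; _≤_; _/_)
open import Relation.Binary.PropositionalEquality using (_≡_; _≢_)
open import Relation.Nullary using (¬_)
open import Relation.Nullary.Decidable using (⌊_⌋)

record Graph (n : ℕ) : Set where
  field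
    adj   : Fin n → Fin n → Bool
    sym   : ∀ x y → adj x y ≡ adj y x
    irref : ∀ x → adj x x ≡ false
open Graph public

reach : ∀ {n} → Graph n → ℕ → Fin n → Fin n → Bool
reach {n} G zero    x y = ⌊ x ≟ᶠ y ⌋
reach {n} G (suc m) x y =
  reach G m x y ∨ any (λ z → adj G x z ∧ reach G m z y) (allFin n)

Connected : ∀ {n} → Graph n → Set
Connected G = ∀ x y → ∃ λ m → reach G m x y ≡ true

-- least m ≤ k with p m = true, and k+1 if there is none.
leastUpTo : (ℕ → Bool) → ℕ → ℕ
leastUpTo p zero    = if p 0 then 0 else 1
leastUpTo p (suc k) = if p 0 then 0 else suc (leastUpTo (λ i → p (suc i)) k)

-- truncated distance d_k(x,y) = min { d(x,y), k+1 }
dTrunc : ∀ {n} → Graph n → ℕ → Fin n → Fin n → ℕ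
dTrunc G k x y = leastUpTo (λ m → reach G m x y) k

inR : ∀ {n} → Graph n → ℕ → Fin n → Fin n → Fin n → Bool
inR G k x y z = if ⌊ dTrunc G k x z Data.Nat.≟ dTrunc G k y z ⌋ then false else true

sumOver : ∀ {n} → (Fin n → Bool) → (Fin n → ℚ) → ℚ
sumOver {n} U g = foldr _+_ 0ℚ (map (λ s → if U s then g s else 0ℚ) (allFin n))

total : ∀ {n} → (Fin n → ℚ) → ℚ
total g = sumOver (λ _ → true) g

IsKResolvingFunction : ∀ {n} → Graph n → ℕ → (Fin n → ℚ) → Set
IsKResolvingFunction G k h =
  (∀ v → (0ℚ ≤ h v) × (h v ≤ 1ℚ)) ×
  (∀ x y → x ≢ y → 1ℚ ≤ sumOver (inR G k x y) h)

FracTruncDimIs : ∀ {n} → Graph n → ℕ → ℚ → Set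
FracTruncDimIs G k r =
  (Σ _ λ h → IsKResolvingFunction G k h × total h ≡ r) ×
  (∀ h → IsKResolvingFunction G k h → r ≤ total h)

-- G ∈ H[K ∪ K̄]: V(G) is partitioned by f into classes indexed by V(H), each class
-- has at least 2 vertices and induces a complete or an edgeless graph, and vertices
-- in distinct classes i ≠ j are adjacent iff ij ∈ E(H).
IsBlowupOf : ∀ {n m} → Graph n → Graph m → Set
IsBlowupOf {n} {m} G H = Σ (Fin n → Fin m) λ f →
  (∀ i → Σ (Fin n) λ u → Σ (Fin n) λ v → u ≢ v × f u ≡ i × f v ≡ i) ×
  (∀ i → (∀ u v → f u ≡ i → f v ≡ i → u ≢ v → adj G u v ≡ true)
       ⊎ (∀ u v → f u ≡ i → f v ≡ i → adj G u v ≡ false)) ×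
  (∀ u v → f u ≢ f v → adj G u v ≡ adj H (f u) (f v))

InBlowupFamily : ∀ {n} → Graph n → Set
InBlowupFamily G = Σ ℕ λ m → Σ (Graph m) λ H → Connected H × IsBlowupOf G H

{-# OPTIONS --safe #-}
module Submission where

-- For k = 1, R{x,y} consists of x, y and the vertices adjacent to exactly one of them, so
-- R{u,v} = {u,v} exactly when u and v are twins (same neighbours outside {u,v}). The constant
-- function ½ always resolves, so dim ≤ n/2. If a vertex w has no twin, every pair is resolved
-- by two vertices other than w, so lowering the weight of w to 0 gives dim < n/2. If every
-- vertex has a twin, G is the blow-up of its quotient by the (transitive) twin relation, whose
-- classes are cliques or independent sets. Conversely, vertices in one class of a blow-up are
-- twins, so a resolving h has h u + h v ≥ 1 on them; each class has at most one vertex of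
-- weight < ½, and matching it with another vertex of its class gives 2 h(V) ≥ n.

open import Defs hiding (sym)
open import Defs using () renaming (sym to adj-sym)
open import Data.Nat using (ℕ; zero; suc; _≥_) renaming (_≟_ to _≟ℕ_)
open import Data.Bool using (Bool; true; false; T; if_then_else_; _∨_; _∧_)
open import Data.Bool.Properties using (T-≡; T-∨; T-∧; ⇔→≡) renaming (_≟_ to _≟ᵇ_)
open import Data.Bool.ListAction using (any)
open import Data.Fin using (Fin; zero; suc)
open import Data.Fin.Properties using (any?; all?; ¬∀⟶∃¬) renaming (_≟_ to _≟ᶠ_)
import Data.Fin.Permutation as Permutation
open import Data.List using (List; _∷_; allFin; tabulate; filter; lookup; length; foldr)
open import Data.List.Properties using (map-tabulate)
open import Data.List.Membership.Propositional using (_∈_)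
open import Data.List.Membership.Propositional.Properties
  using (∈-allFin; ∈-filter⁺; ∈-filter⁻; ∈-lookup)
open import Data.List.Membership.Propositional.Properties.WithK using (unique⇒irrelevant)
open import Data.List.Relation.Unary.Any using (index)
open import Data.List.Relation.Unary.Any.Properties using (any⁺; any⁻; tabulate⁺; tabulate⁻; lookup-index)
open import Data.List.Relation.Unary.Unique.Propositional using (Unique)
open import Data.List.Relation.Unary.Unique.Propositional.Properties using (allFin⁺; filter⁺)
open import Data.Maybe using (Maybe; just; nothing; fromMaybe)
import Data.Maybe as Maybe
open import Data.Product using (Σ; ∃; ∃₂; _×_; _,_; proj₁; proj₂)
open import Data.Sum using (_⊎_; inj₁; inj₂)
open import Data.Empty using (⊥-elim)
open import Data.Integer using (+_)
import Data.Integer as ℤ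
open import Data.Integer.Tactic.RingSolver using (solve-∀)
open import Data.Rational using (ℚ; 0ℚ; 1ℚ; ½; _+_; _≤_; _<_; _/_; toℚᵘ)
import Data.Rational.Properties as ℚ
import Data.Rational.Unnormalised as ℚᵘ
import Data.Rational.Unnormalised.Properties as ℚᵘ
open import Algebra.Properties.CommutativeMonoid.Sum ℚ.+-0-commutativeMonoid
  using (sum; sum-replicate-zero; sum-cong-≗; ∑-distrib-+; sum-permute)
open import Relation.Binary using (Rel; IsDecEquivalence)
open import Relation.Binary.PropositionalEquality
open import Relation.Nullary using (¬_; Dec; yes; no; contradiction)
open import Relation.Nullary.Decidable
  using (does; ⌊_⌋; isYes≗does; dec-true; dec-false; toWitness; fromWitness; from-yes; ¬?; _×-dec_; _→-dec_)
open import Function using (_∘_; id; case_of_; _⇔_; mk⇔; Equivalence)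

open Equivalence using (to; from)

-- (+ n) / 2 is by definition the normalisation fromℚᵘ (+ n ℚᵘ./ 2).
½+[n/2]≡[1+n]/2 : ∀ n → ½ + (+ n) / 2 ≡ (+ suc n) / 2
½+[n/2]≡[1+n]/2 n = ℚ.toℚᵘ-injective (begin
  toℚᵘ (½ + (+ n) / 2)               ≈⟨ ℚ.toℚᵘ-homo-+ ½ ((+ n) / 2) ⟩
  toℚᵘ ½ ℚᵘ.+ toℚᵘ ((+ n) / 2)       ≈⟨ ℚᵘ.+-congʳ (toℚᵘ ½) (ℚ.toℚᵘ-fromℚᵘ (+ n ℚᵘ./ 2)) ⟩
  + 1 ℚᵘ./ 2 ℚᵘ.+ + n ℚᵘ./ 2         ≈⟨ ℚᵘ.*≡* (cross-multiplied (+ n)) ⟩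
  + suc n ℚᵘ./ 2                     ≈⟨ ℚ.toℚᵘ-fromℚᵘ (+ suc n ℚᵘ./ 2) ⟨
  toℚᵘ ((+ suc n) / 2)               ∎)
  where
  open ℚᵘ.≃-Reasoning
  cross-multiplied : ∀ x → (+ 1 ℤ.* + 2 ℤ.+ x ℤ.* + 2) ℤ.* + 2 ≡ (+ 1 ℤ.+ x) ℤ.* (+ 2 ℤ.* + 2)
  cross-multiplied = solve-∀

sum-const-½ : ∀ n → sum {n} (λ _ → ½) ≡ (+ n) / 2
sum-const-½ zero    = refl
sum-const-½ (suc n) = trans (cong (_+_ ½) (sum-const-½ n)) (½+[n/2]≡[1+n]/2 n)

p+p≤q+q⇒p≤q : ∀ {p q : ℚ} → p + p ≤ q + q → p ≤ q
p+p≤q+q⇒p≤q p+p≤q+q = ℚ.≮⇒≥ λ q<p → ℚ.<-irrefl refl (ℚ.<-≤-trans (ℚ.+-mono-< q<p q<p) p+p≤q+q)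

0≤½ : 0ℚ ≤ ½
0≤½ = from-yes (0ℚ ℚ.≤? ½)

½≤1 : ½ ≤ 1ℚ
½≤1 = from-yes (½ ℚ.≤? 1ℚ)

0<½ : 0ℚ < ½
0<½ = from-yes (0ℚ ℚ.<? ½)

0≤1 : 0ℚ ≤ 1ℚ
0≤1 = from-yes (0ℚ ℚ.≤? 1ℚ)

sum-mono-≤ : ∀ {n} {f g : Fin n → ℚ} → (∀ i → f i ≤ g i) → sum f ≤ sum g
sum-mono-≤ {zero}  f≤g = ℚ.≤-refl
sum-mono-≤ {suc n} f≤g = ℚ.+-mono-≤ (f≤g zero) (sum-mono-≤ (f≤g ∘ suc))

sum-mono-< : ∀ {n} {f g : Fin n → ℚ} → (∀ i → f i ≤ g i) → ∀ j → f j < g j → sum f < sum g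
sum-mono-< f≤g zero    fj<gj = ℚ.+-mono-<-≤ fj<gj (sum-mono-≤ (f≤g ∘ suc))
sum-mono-< f≤g (suc j) fj<gj = ℚ.+-mono-≤-< (f≤g zero) (sum-mono-< (f≤g ∘ suc) j fj<gj)

sum-if-≟ : ∀ {n} (g : Fin n → ℚ) a → sum (λ s → if does (s ≟ᶠ a) then g s else 0ℚ) ≡ g a
sum-if-≟ {suc n} g zero    = trans (cong (_+_ (g zero)) (sum-replicate-zero n)) (ℚ.+-identityʳ (g zero))
sum-if-≟ {suc n} g (suc a) = trans (ℚ.+-identityˡ _) (sum-if-≟ (g ∘ suc) a)

foldr-+-tabulate : ∀ {n} (g : Fin n → ℚ) → foldr _+_ 0ℚ (tabulate g) ≡ sum g
foldr-+-tabulate {zero}  g = refl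
foldr-+-tabulate {suc n} g = cong (_+_ (g zero)) (foldr-+-tabulate (g ∘ suc))

sumOver≡sum : ∀ {n} (U : Fin n → Bool) g → sumOver U g ≡ sum (λ s → if U s then g s else 0ℚ)
sumOver≡sum {n} U g = trans (cong (foldr _+_ 0ℚ) (map-tabulate {n = n} id f)) (foldr-+-tabulate f)
  where
  f : Fin n → ℚ
  f s = if U s then g s else 0ℚ

total≡sum : ∀ {n} (g : Fin n → ℚ) → total g ≡ sum g
total≡sum = sumOver≡sum (λ _ → true)

total-const-½ : ∀ n → total {n} (λ _ → ½) ≡ (+ n) / 2
total-const-½ n = trans (total≡sum {n} (λ _ → ½)) (sum-const-½ n)

sumOver-mono-⊆ : ∀ {n} {U V : Fin n → Bool} {g : Fin n → ℚ} → (∀ s → 0ℚ ≤ g s) →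
  (∀ s → U s ≡ true → V s ≡ true) → sumOver U g ≤ sumOver V g
sumOver-mono-⊆ {U = U} {V} {g} g≥0 U⊆V =
  subst₂ _≤_ (sym (sumOver≡sum U g)) (sym (sumOver≡sum V g)) (sum-mono-≤ pointwise)
  where
  pointwise : ∀ s → (if U s then g s else 0ℚ) ≤ (if V s then g s else 0ℚ)
  pointwise s with U s in Us | V s in Vs
  ... | true  | true  = ℚ.≤-refl
  ... | true  | false = contradiction (trans (sym (U⊆V s Us)) Vs) λ ()
  ... | false | true  = g≥0 s
  ... | false | false = ℚ.≤-refl

⁅_,_⁆ : ∀ {n} → Fin n → Fin n → Fin n → Bool
⁅ a , b ⁆ s = does (s ≟ᶠ a) ∨ does (s ≟ᶠ b)

sumOver-pair : ∀ {n} {a b : Fin n} (g : Fin n → ℚ) → a ≢ b → sumOver ⁅ a , b ⁆ g ≡ g a + g b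
sumOver-pair {a = a} {b} g a≢b = begin
  sumOver ⁅ a , b ⁆ g                         ≡⟨ sumOver≡sum ⁅ a , b ⁆ g ⟩
  sum (λ s → if ⁅ a , b ⁆ s then g s else 0ℚ) ≡⟨ sum-cong-≗ split ⟩
  sum (λ s → at a s + at b s)                 ≡⟨ ∑-distrib-+ (at a) (at b) ⟩
  sum (at a) + sum (at b)                     ≡⟨ cong₂ _+_ (sum-if-≟ g a) (sum-if-≟ g b) ⟩
  g a + g b                                   ∎
  where
  open ≡-Reasoning
  at : _ → _ → ℚ
  at c s = if does (s ≟ᶠ c) then g s else 0ℚ
  split : ∀ s → (if ⁅ a , b ⁆ s then g s else 0ℚ) ≡ at a s + at b s
  split s with s ≟ᶠ a | s ≟ᶠ b
  ... | yes refl | yes refl = contradiction refl a≢b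
  ... | yes _    | no _     = sym (ℚ.+-identityʳ (g s))
  ... | no _     | yes _    = sym (ℚ.+-identityˡ (g s))
  ... | no _     | no _     = refl

pair-≤-sumOver : ∀ {n} {U : Fin n → Bool} {g : Fin n → ℚ} {a b} → (∀ s → 0ℚ ≤ g s) →
  a ≢ b → U a ≡ true → U b ≡ true → g a + g b ≤ sumOver U g
pair-≤-sumOver {U = U} {g} {a} {b} g≥0 a≢b Ua Ub =
  subst (_≤ sumOver U g) (sumOver-pair g a≢b) (sumOver-mono-⊆ g≥0 pair⊆U)
  where
  pair⊆U : ∀ s → ⁅ a , b ⁆ s ≡ true → U s ≡ true
  pair⊆U s with s ≟ᶠ a | s ≟ᶠ b
  ... | yes refl | _        = λ _ → Ua
  ... | no _     | yes refl = λ _ → Ub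
  ... | no _     | no _     = λ ()

sumOver-≤-pair : ∀ {n} {U : Fin n → Bool} {g : Fin n → ℚ} {a b} → (∀ s → 0ℚ ≤ g s) →
  a ≢ b → (∀ s → U s ≡ true → s ≡ a ⊎ s ≡ b) → sumOver U g ≤ g a + g b
sumOver-≤-pair {U = U} {g} {a} {b} g≥0 a≢b U⊆pair =
  subst (sumOver U g ≤_) (sumOver-pair g a≢b) (sumOver-mono-⊆ g≥0 U⊆⁅a,b⁆)
  where
  U⊆⁅a,b⁆ : ∀ s → U s ≡ true → ⁅ a , b ⁆ s ≡ true
  U⊆⁅a,b⁆ s Us with U⊆pair s Us | s ≟ᶠ a | s ≟ᶠ b
  ... | _        | yes _ | _     = refl
  ... | _        | no _  | yes _ = refl
  ... | inj₁ s≡a | no s≢a | no _ = contradiction s≡a s≢a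
  ... | inj₂ s≡b | no _ | no s≢b = contradiction s≡b s≢b

-- Truncated distances

any-allFin : ∀ {n} (p : Fin n → Bool) → T (any p (allFin n)) ⇔ ∃ λ i → T (p i)
any-allFin p = mk⇔ (tabulate⁻ ∘ any⁻ p _) (λ (i , pi) → any⁺ p (tabulate⁺ i pi))

leastUpTo≡0 : ∀ p k → p 0 ≡ true → leastUpTo p k ≡ 0
leastUpTo≡0 p zero    p0 rewrite p0 = refl
leastUpTo≡0 p (suc k) p0 rewrite p0 = refl

leastUpTo≡0⇒ : ∀ p k → leastUpTo p k ≡ 0 → p 0 ≡ true
leastUpTo≡0⇒ p zero with p 0
... | true  = λ _ → refl
... | false = λ ()
leastUpTo≡0⇒ p (suc k) with p 0
... | true  = λ _ → refl
... | false = λ ()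

⌊⌋-true : ∀ {a} {A : Set a} (a? : Dec A) → A → ⌊ a? ⌋ ≡ true
⌊⌋-true a? a = trans (isYes≗does a?) (dec-true a? a)

⌊⌋-false : ∀ {a} {A : Set a} (a? : Dec A) → ¬ A → ⌊ a? ⌋ ≡ false
⌊⌋-false a? ¬a = trans (isYes≗does a?) (dec-false a? ¬a)

module _ {n} (G : Graph n) where

  dTrunc-refl : ∀ k x → dTrunc G k x x ≡ 0
  dTrunc-refl k x = leastUpTo≡0 _ k (⌊⌋-true (x ≟ᶠ x) refl)

  dTrunc≡0⇒≡ : ∀ k {x y} → dTrunc G k x y ≡ 0 → x ≡ y
  dTrunc≡0⇒≡ k {x} {y} d≡0 = toWitness {a? = x ≟ᶠ y} (T-≡ .from (leastUpTo≡0⇒ _ k d≡0))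

  any-adj-≟ : ∀ x z → any (λ w → adj G x w ∧ ⌊ w ≟ᶠ z ⌋) (allFin n) ≡ adj G x z
  any-adj-≟ x z = ⇔→≡ (mk⇔ (T-≡ .to ∘ adjacent ∘ any-allFin _ .to ∘ T-≡ .from)
                           (λ e → T-≡ .to (any-allFin _ .from (z , T-∧ .from (T-≡ .from e , fromWitness refl)))))
    where
    adjacent : (∃ λ w → T (adj G x w ∧ ⌊ w ≟ᶠ z ⌋)) → T (adj G x z)
    adjacent (w , t) with T-∧ .to t
    ... | xw , w≡z = subst (T ∘ adj G x) (toWitness {a? = w ≟ᶠ z} w≡z) xw

  dTrunc₁ : ∀ {x z} → x ≢ z → dTrunc G 1 x z ≡ (if adj G x z then 1 else 2)
  dTrunc₁ {x} {z} x≢z rewrite ⌊⌋-false (x ≟ᶠ z) x≢z | any-adj-≟ x z with adj G x z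
  ... | true  = refl
  ... | false = refl

  inR-true : ∀ {k x y z} → dTrunc G k x z ≢ dTrunc G k y z → inR G k x y z ≡ true
  inR-true {k} {x} {y} {z} d≢ rewrite ⌊⌋-false (dTrunc G k x z ≟ℕ dTrunc G k y z) d≢ = refl

  inR-false : ∀ {k x y z} → dTrunc G k x z ≡ dTrunc G k y z → inR G k x y z ≡ false
  inR-false {k} {x} {y} {z} d≡ rewrite ⌊⌋-true (dTrunc G k x z ≟ℕ dTrunc G k y z) d≡ = refl

  inR-left : ∀ k {x y} → x ≢ y → inR G k x y x ≡ true
  inR-left k {x} {y} x≢y = inR-true {k} {x} {y} {x} λ d≡ → x≢y (sym (dTrunc≡0⇒≡ k (trans (sym d≡) (dTrunc-refl k x))))

  inR-right : ∀ k {x y} → x ≢ y → inR G k x y y ≡ true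
  inR-right k {x} {y} x≢y = inR-true {k} {x} {y} {y} λ d≡ → x≢y (dTrunc≡0⇒≡ k (trans d≡ (dTrunc-refl k y)))

  inR₁-true : ∀ {x y z} → z ≢ x → z ≢ y → adj G x z ≢ adj G y z → inR G 1 x y z ≡ true
  inR₁-true {x} {y} {z} z≢x z≢y adj≢ = inR-true {1} {x} {y} {z} λ d≡ →
    adj≢ (if-1-2-injective (trans (sym (dTrunc₁ (z≢x ∘ sym))) (trans d≡ (dTrunc₁ (z≢y ∘ sym)))))
    where
    if-1-2-injective : ∀ {a b} → (if a then 1 else 2) ≡ (if b then 1 else 2) → a ≡ b
    if-1-2-injective {true}  {true}  _ = refl
    if-1-2-injective {false} {false} _ = refl

  inR₁-false : ∀ {x y z} → z ≢ x → z ≢ y → adj G x z ≡ adj G y z → inR G 1 x y z ≡ false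
  inR₁-false {x} {y} {z} z≢x z≢y adj≡ = inR-false {1} {x} {y} {z} (begin
    dTrunc G 1 x z                 ≡⟨ dTrunc₁ (z≢x ∘ sym) ⟩
    (if adj G x z then 1 else 2)   ≡⟨ cong (λ b → if b then 1 else 2) adj≡ ⟩
    (if adj G y z then 1 else 2)   ≡⟨ dTrunc₁ (z≢y ∘ sym) ⟨
    dTrunc G 1 y z                 ∎)
    where open ≡-Reasoning

-- Twins

Twins : ∀ {n} → Graph n → Fin n → Fin n → Set
Twins G u v = ∀ z → z ≢ u → z ≢ v → adj G u z ≡ adj G v z

module _ {n} (G : Graph n) where

  twins-at? : ∀ u v z → Dec (z ≢ u → z ≢ v → adj G u z ≡ adj G v z)
  twins-at? u v z = ¬? (z ≟ᶠ u) →-dec ¬? (z ≟ᶠ v) →-dec (adj G u z ≟ᵇ adj G v z)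

  twins? : ∀ u v → Dec (Twins G u v)
  twins? u v = all? (twins-at? u v)

  twins-refl : ∀ {u} → Twins G u u
  twins-refl _ _ _ = refl

  twins-sym : ∀ {u v} → Twins G u v → Twins G v u
  twins-sym uv z z≢v z≢u = sym (uv z z≢u z≢v)

  twins-swap : ∀ {a b b'} → Twins G b b' → a ≢ b → a ≢ b' → adj G a b ≡ adj G a b'
  twins-swap {a} {b} {b'} bb' a≢b a≢b' = begin
    adj G a b  ≡⟨ adj-sym G a b ⟩
    adj G b a  ≡⟨ bb' a a≢b a≢b' ⟩
    adj G b' a ≡⟨ adj-sym G b' a ⟩
    adj G a b' ∎
    where open ≡-Reasoning

  twins-trans : ∀ {u v w} → Twins G u v → Twins G v w → Twins G u w
  twins-trans {u} {v} {w} uv vw z z≢u z≢w with z ≟ᶠ v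
  ... | no z≢v = trans (uv z z≢u z≢v) (vw z z≢v z≢w)
  ... | yes refl with u ≟ᶠ w
  ...   | yes refl = refl
  ...   | no u≢w = begin
    adj G u z ≡⟨ twins-swap vw (z≢u ∘ sym) u≢w ⟩
    adj G u w ≡⟨ uv w (u≢w ∘ sym) (z≢w ∘ sym) ⟩
    adj G z w ≡⟨ adj-sym G z w ⟩
    adj G w z ∎
    where open ≡-Reasoning

  twins-isDecEquivalence : IsDecEquivalence (Twins G)
  twins-isDecEquivalence = record
    { isEquivalence = record { refl = twins-refl ; sym = twins-sym ; trans = twins-trans }
    ; _≟_           = twins?
    }

  twins-adj : ∀ {x y x' y'} → Twins G x x' → Twins G y y' → Twins G x y' →
    x ≢ y → x' ≢ y' → adj G x y ≡ adj G x' y'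
  twins-adj {x} {y} {x'} {y'} xx' yy' xy' x≢y x'≢y' with x' ≟ᶠ y
  ... | yes refl = trans (adj-sym G x x') (twins-swap xy' (x≢y ∘ sym) x'≢y')
  ... | no x'≢y = trans (xx' y (x≢y ∘ sym) (x'≢y ∘ sym)) (twins-swap yy' x'≢y x'≢y')

  twins⇒inR₁⊆pair : ∀ {u v} → Twins G u v → ∀ z → inR G 1 u v z ≡ true → z ≡ u ⊎ z ≡ v
  twins⇒inR₁⊆pair {u} {v} uv z z∈R with z ≟ᶠ u | z ≟ᶠ v
  ... | yes z≡u | _       = inj₁ z≡u
  ... | no _    | yes z≡v = inj₂ z≡v
  ... | no z≢u  | no z≢v  = contradiction (trans (sym z∈R) (inR₁-false G z≢u z≢v (uv z z≢u z≢v))) λ ()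

  resolving⇒twin-weight : ∀ {h u v} → IsKResolvingFunction G 1 h →
    u ≢ v → Twins G u v → 1ℚ ≤ h u + h v
  resolving⇒twin-weight {h} {u} {v} (bounds , resolves) u≢v uv =
    ℚ.≤-trans (resolves u v u≢v) (sumOver-≤-pair (proj₁ ∘ bounds) u≢v (twins⇒inR₁⊆pair uv))

-- Fractional resolving functions

module _ {n} (G : Graph n) where

  const-½-resolving : ∀ k → IsKResolvingFunction G k (λ _ → ½)
  const-½-resolving k = (λ _ → 0≤½ , ½≤1) , λ x y x≢y →
    pair-≤-sumOver (λ _ → 0≤½) x≢y (inR-left G k x≢y) (inR-right G k x≢y)

  module _ (w : Fin n) (twinless : ∀ v → v ≢ w → ¬ Twins G w v) where

    ½-except-w : Fin n → ℚ
    ½-except-w v = if does (v ≟ᶠ w) then 0ℚ else ½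

    ½-except-w-w : ½-except-w w ≡ 0ℚ
    ½-except-w-w rewrite dec-true (w ≟ᶠ w) refl = refl

    ½-except-w-≢ : ∀ {v} → v ≢ w → ½-except-w v ≡ ½
    ½-except-w-≢ {v} v≢w rewrite dec-false (v ≟ᶠ w) v≢w = refl

    ½-except-w-bounds : ∀ v → (0ℚ ≤ ½-except-w v) × (½-except-w v ≤ 1ℚ)
    ½-except-w-bounds v with does (v ≟ᶠ w)
    ... | true  = ℚ.≤-refl , 0≤1
    ... | false = 0≤½ , ½≤1

    ½-except-w-≤-½ : ∀ v → ½-except-w v ≤ ½
    ½-except-w-≤-½ v with does (v ≟ᶠ w)
    ... | true  = 0≤½
    ... | false = ℚ.≤-refl

    distinguisher : ∀ {y} → y ≢ w → ∃ λ z → z ≢ w × z ≢ y × adj G w z ≢ adj G y z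
    distinguisher {y} y≢w with ¬∀⟶∃¬ n _ (twins-at? G w y) (twinless y y≢w)
    ... | z , ¬twin-at-z = z , (λ z≡w → ¬twin-at-z λ z≢w → contradiction z≡w z≢w)
                             , (λ z≡y → ¬twin-at-z λ _ z≢y → contradiction z≡y z≢y)
                             , (λ adj≡ → ¬twin-at-z λ _ _ → adj≡)

    two-away-from-w : ∀ {x y} → x ≢ y →
      ∃₂ λ a b → a ≢ b × a ≢ w × b ≢ w × inR G 1 x y a ≡ true × inR G 1 x y b ≡ true
    two-away-from-w {x} {y} x≢y with x ≟ᶠ w | y ≟ᶠ w
    ... | yes refl | yes refl = contradiction refl x≢y
    ... | yes refl | no y≢w with distinguisher y≢w
    ...   | z , z≢w , z≢y , adj≢ =
      y , z , (z≢y ∘ sym) , y≢w , z≢w , inR-right G 1 x≢y , inR₁-true G z≢w z≢y adj≢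
    two-away-from-w {x} {y} x≢y | no x≢w | yes refl with distinguisher x≢w
    ...   | z , z≢w , z≢x , adj≢ =
      x , z , (z≢x ∘ sym) , x≢w , z≢w , inR-left G 1 x≢y , inR₁-true G z≢x z≢w (adj≢ ∘ sym)
    two-away-from-w {x} {y} x≢y | no x≢w | no y≢w =
      x , y , x≢y , x≢w , y≢w , inR-left G 1 x≢y , inR-right G 1 x≢y

    ½-except-w-resolving : IsKResolvingFunction G 1 ½-except-w
    ½-except-w-resolving = ½-except-w-bounds , λ x y x≢y → resolves (two-away-from-w x≢y)
      where
      resolves : ∀ {x y} → (∃₂ λ a b → a ≢ b × a ≢ w × b ≢ w × inR G 1 x y a ≡ true × inR G 1 x y b ≡ true) →
        1ℚ ≤ sumOver (inR G 1 x y) ½-except-w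
      resolves (a , b , a≢b , a≢w , b≢w , a∈R , b∈R) =
        subst (_≤ _) (cong₂ _+_ (½-except-w-≢ a≢w) (½-except-w-≢ b≢w))
          (pair-≤-sumOver (proj₁ ∘ ½-except-w-bounds) a≢b a∈R b∈R)

    total-½-except-w<n/2 : total ½-except-w < (+ n) / 2
    total-½-except-w<n/2 = subst₂ _<_ (sym (total≡sum ½-except-w)) (sum-const-½ n)
      (sum-mono-< ½-except-w-≤-½ w (subst (_< ½) (sym ½-except-w-w) 0<½))

  dim≡n/2⇒twins : FracTruncDimIs G 1 ((+ n) / 2) → ∀ w → ∃ λ v → v ≢ w × Twins G w v
  dim≡n/2⇒twins (_ , minimal) w with any? (λ v → ¬? (v ≟ᶠ w) ×-dec twins? G w v)
  ... | yes twin = twin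
  ... | no noTwin = ⊥-elim (ℚ.<-irrefl refl
    (ℚ.≤-<-trans (minimal _ (½-except-w-resolving w twinless)) (total-½-except-w<n/2 w twinless)))
    where
    twinless : ∀ v → v ≢ w → ¬ Twins G w v
    twinless v v≢w wv = noTwin (v , v≢w , wv)

module ClassMatching {n} {A : Set} (class : Fin n → A) (h : Fin n → ℚ)
  (has-partner : ∀ u → ∃ λ v → v ≢ u × class v ≡ class u)
  (pair-bound : ∀ {u v} → u ≢ v → class u ≡ class v → 1ℚ ≤ h u + h v) where

  partner : Fin n → Fin n
  partner u = proj₁ (has-partner u)

  partner-≢ : ∀ u → partner u ≢ u
  partner-≢ u = proj₁ (proj₂ (has-partner u))

  class-partner : ∀ u → class (partner u) ≡ class u
  class-partner u = proj₂ (proj₂ (has-partner u))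

  Light : Fin n → Set
  Light u = h u < ½

  light-unique : ∀ {u v} → Light u → Light v → class u ≡ class v → u ≡ v
  light-unique {u} {v} lu lv same with u ≟ᶠ v
  ... | yes u≡v = u≡v
  ... | no u≢v  = ⊥-elim (ℚ.<-irrefl refl (ℚ.<-≤-trans (ℚ.+-mono-< lu lv) (pair-bound u≢v same)))

  -- A class contains at most one light vertex; pairing each light vertex with its partner and
  -- fixing every other vertex gives an involution `mate` with 1 ≤ h u + h (mate u) everywhere.
  data Mate (u : Fin n) : Fin n → Set where
    light   : Light u → Mate u (partner u)
    matched : ∀ {w} → ¬ Light u → Light w → partner w ≡ u → Mate u w
    single  : ¬ Light u → (∀ w → ¬ (Light w × partner w ≡ u)) → Mate u u

  mate-of : ∀ u → ∃ (Mate u)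
  mate-of u with h u ℚ.<? ½
  ... | yes lu = partner u , light lu
  ... | no ¬lu with any? (λ w → (h w ℚ.<? ½) ×-dec (partner w ≟ᶠ u))
  ...   | yes (w , lw , pw≡u) = w , matched ¬lu lw pw≡u
  ...   | no none             = u , single ¬lu λ w light-matched → none (w , light-matched)

  mate : Fin n → Fin n
  mate u = proj₁ (mate-of u)

  mate-unique : ∀ {u v v'} → Mate u v → Mate u v' → v ≡ v'
  mate-unique (light _)          (light _)           = refl
  mate-unique (light lu)         (matched ¬lu _ _)   = contradiction lu ¬lu
  mate-unique (light lu)         (single ¬lu _)      = contradiction lu ¬lu
  mate-unique (matched ¬lu _ _)  (light lu)          = contradiction lu ¬lu
  mate-unique (matched _ lw pw)  (matched _ lw' pw') =
    light-unique lw lw' (trans (sym (class-partner _)) (trans (cong class (trans pw (sym pw'))) (class-partner _)))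
  mate-unique (matched _ lw pw)  (single _ none)     = contradiction (lw , pw) (none _)
  mate-unique (single ¬lu _)     (light lu)          = contradiction lu ¬lu
  mate-unique (single _ none)    (matched _ lw pw)   = contradiction (lw , pw) (none _)
  mate-unique (single _ _)       (single _ _)        = refl

  mate-swap : ∀ {u v} → Mate u v → Mate v u
  mate-swap {u} (light lu)          = matched (λ lt → partner-≢ u (light-unique lt lu (class-partner u))) lu refl
  mate-swap     (matched _ lw pw≡u) = subst (Mate _) pw≡u (light lw)
  mate-swap     (single ¬lu none)   = single ¬lu none

  mate-involutive : ∀ u → mate (mate u) ≡ u
  mate-involutive u = mate-unique (proj₂ (mate-of (mate u))) (mate-swap (proj₂ (mate-of u)))

  mate-bound : ∀ {u v} → Mate u v → 1ℚ ≤ h u + h v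
  mate-bound {u} (light _)          = pair-bound (partner-≢ u ∘ sym) (sym (class-partner u))
  mate-bound     (matched _ _ pw≡u) =
    pair-bound (λ u≡w → partner-≢ _ (trans pw≡u u≡w)) (trans (cong class (sym pw≡u)) (class-partner _))
  mate-bound     (single ¬lu _)     = ℚ.+-mono-≤ (ℚ.≮⇒≥ ¬lu) (ℚ.≮⇒≥ ¬lu)

  n/2≤sum : (+ n) / 2 ≤ sum h
  n/2≤sum = p+p≤q+q⇒p≤q (begin
    (+ n) / 2 + (+ n) / 2                  ≡⟨ cong₂ _+_ (sum-const-½ n) (sum-const-½ n) ⟨
    sum {n} (λ _ → ½) + sum {n} (λ _ → ½)  ≡⟨ ∑-distrib-+ {n} (λ _ → ½) (λ _ → ½) ⟨
    sum {n} (λ _ → 1ℚ)                     ≤⟨ sum-mono-≤ (mate-bound ∘ proj₂ ∘ mate-of) ⟩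
    sum (λ u → h u + h (mate u))           ≡⟨ ∑-distrib-+ h (h ∘ mate) ⟩
    sum h + sum (h ∘ mate)                 ≡⟨ cong (_+_ (sum h)) (sum-permute h π) ⟨
    sum h + sum h                          ∎)
    where
    open ℚ.≤-Reasoning
    π : Permutation.Permutation′ n
    π = Permutation.permutation mate mate mate-involutive mate-involutive

classPairs⇒n/2≤sum : ∀ {n} {A : Set} (class : Fin n → A) (h : Fin n → ℚ) →
  (∀ u → ∃ λ v → v ≢ u × class v ≡ class u) →
  (∀ {u v} → u ≢ v → class u ≡ class v → 1ℚ ≤ h u + h v) →
  (+ n) / 2 ≤ sum h
classPairs⇒n/2≤sum = ClassMatching.n/2≤sum

-- Blow-ups

module _ {n m} {G : Graph n} {H : Graph m} where

  blowup-sameClass⇒twins : ((f , _) : IsBlowupOf G H) → ∀ {u v} → f u ≡ f v → Twins G u v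
  blowup-sameClass⇒twins (f , _ , homogeneous , cross) {u} {v} fu≡fv z z≢u z≢v with f z ≟ᶠ f u
  ... | yes fz≡fu with homogeneous (f u)
  ...   | inj₁ clique      = trans (clique u z refl fz≡fu (z≢u ∘ sym))
                                   (sym (clique v z (sym fu≡fv) fz≡fu (z≢v ∘ sym)))
  ...   | inj₂ independent = trans (independent u z refl fz≡fu) (sym (independent v z (sym fu≡fv) fz≡fu))
  blowup-sameClass⇒twins (f , _ , _ , cross) {u} {v} fu≡fv z z≢u z≢v | no fz≢fu = begin
    adj G u z           ≡⟨ cross u z (fz≢fu ∘ sym) ⟩
    adj H (f u) (f z)   ≡⟨ cong (λ i → adj H i (f z)) fu≡fv ⟩
    adj H (f v) (f z)   ≡⟨ cross v z (λ fv≡fz → fz≢fu (trans (sym fv≡fz) (sym fu≡fv))) ⟨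
    adj G v z           ∎
    where open ≡-Reasoning

  blowup⇒dim≡n/2 : IsBlowupOf G H → FracTruncDimIs G 1 ((+ n) / 2)
  blowup⇒dim≡n/2 blowup@(f , classes , _) =
      ((λ _ → ½) , const-½-resolving G 1 , total-const-½ n)
    , λ h resolving → subst ((+ n) / 2 ≤_) (sym (total≡sum h))
        (classPairs⇒n/2≤sum f h has-partner λ u≢v fu≡fv →
          resolving⇒twin-weight G resolving u≢v (blowup-sameClass⇒twins blowup fu≡fv))
    where
    has-partner : ∀ u → ∃ λ v → v ≢ u × f v ≡ f u
    has-partner u with classes (f u)
    ... | a , b , a≢b , fa , fb with u ≟ᶠ a
    ...   | yes refl = b , (a≢b ∘ sym) , fb
    ...   | no u≢a   = a , (u≢a ∘ sym) , fa

-- Quotients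

first : ∀ {n} → (Fin n → Bool) → Maybe (Fin n)
first {zero}  p = nothing
first {suc n} p = if p zero then just zero else Maybe.map suc (first (p ∘ suc))

first-cong : ∀ {n} {p q : Fin n → Bool} → (∀ i → p i ≡ q i) → first p ≡ first q
first-cong {zero}  p≗q = refl
first-cong {suc n} {p} {q} p≗q rewrite p≗q zero | first-cong {p = p ∘ suc} {q ∘ suc} (p≗q ∘ suc) = refl

first-complete : ∀ {n} (p : Fin n → Bool) i → p i ≡ true → ∃ λ j → first p ≡ just j × p j ≡ true
first-complete {suc n} p i pi with p zero in p0
... | true = zero , refl , p0
first-complete {suc n} p zero    pi | false = contradiction (trans (sym p0) pi) λ ()
first-complete {suc n} p (suc i) pi | false with first-complete (p ∘ suc) i pi
... | j , first≡j , pj rewrite first≡j = suc j , refl , pj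

index-∈-lookup : ∀ {A : Set} (xs : List A) i → index (∈-lookup {xs = xs} i) ≡ i
index-∈-lookup (x ∷ xs) zero    = refl
index-∈-lookup (x ∷ xs) (suc i) = cong suc (index-∈-lookup xs i)

index-unique : ∀ {A : Set} {xs : List A} {x y} → Unique xs →
  (p : x ∈ xs) (q : y ∈ xs) → x ≡ y → index p ≡ index q
index-unique unique p q refl = cong index (unique⇒irrelevant unique p q)

module FinQuotient {n ℓ} {_≈_ : Rel (Fin n) ℓ} (isDecEquivalence : IsDecEquivalence _≈_) where
  open IsDecEquivalence isDecEquivalence using ()
    renaming (_≟_ to _≈?_; refl to ≈-refl; sym to ≈-sym; trans to ≈-trans; reflexive to ≈-reflexive)

  -- Abstract: only the characterising lemmas are needed, and unfolding `class` makes
  -- unification problems about the quotient graph blow up.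
  abstract
    canonical : Fin n → Fin n
    canonical u = fromMaybe u (first λ v → ⌊ v ≈? u ⌋)

    canonical-≈ : ∀ u → canonical u ≈ u
    canonical-≈ u with first-complete (λ v → ⌊ v ≈? u ⌋) u (⌊⌋-true (u ≈? u) ≈-refl)
    ... | j , first≡j , j≈u rewrite first≡j = toWitness {a? = j ≈? u} (T-≡ .from j≈u)

    canonical-cong : ∀ {u v} → u ≈ v → canonical u ≡ canonical v
    canonical-cong {u} {v} u≈v with first-complete (λ w → ⌊ w ≈? v ⌋) v (⌊⌋-true (v ≈? v) ≈-refl)
    ... | j , first≡j , _ = trans (cong (fromMaybe u) (trans (first-cong sameClass) first≡j))
                                  (cong (fromMaybe v) (sym first≡j))
      where
      sameClass : ∀ w → ⌊ w ≈? u ⌋ ≡ ⌊ w ≈? v ⌋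
      sameClass w with w ≈? u | w ≈? v
      ... | yes _   | yes _   = refl
      ... | no _    | no _    = refl
      ... | yes w≈u | no w≉v  = contradiction (≈-trans w≈u u≈v) w≉v
      ... | no w≉u  | yes w≈v = contradiction (≈-trans w≈v (≈-sym u≈v)) w≉u

    canonicals : List (Fin n)
    canonicals = filter (λ u → canonical u ≟ᶠ u) (allFin n)

    canonicals-unique : Unique canonicals
    canonicals-unique = filter⁺ _ (allFin⁺ n)

    canonical-∈ : ∀ u → canonical u ∈ canonicals
    canonical-∈ u = ∈-filter⁺ _ (∈-allFin _) (canonical-cong (canonical-≈ u))

    m : ℕ
    m = length canonicals

    class : Fin n → Fin m
    class u = index (canonical-∈ u)

    member : Fin m → Fin n
    member = lookup canonicals

    class-member : ∀ i → class (member i) ≡ i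
    class-member i = trans (index-unique canonicals-unique (canonical-∈ (member i)) (∈-lookup i) canonical-member)
                        (index-∈-lookup canonicals i)
      where
      canonical-member : canonical (member i) ≡ member i
      canonical-member = proj₂ (∈-filter⁻ (λ u → canonical u ≟ᶠ u) {xs = allFin n} (∈-lookup i))

    ≈⇒class≡ : ∀ {u v} → u ≈ v → class u ≡ class v
    ≈⇒class≡ u≈v = index-unique canonicals-unique _ _ (canonical-cong u≈v)

    class≡⇒≈ : ∀ {u v} → class u ≡ class v → u ≈ v
    class≡⇒≈ {u} {v} class≡ = ≈-trans (≈-sym (canonical-≈ u)) (≈-trans (≈-reflexive canonical≡) (canonical-≈ v))
      where
      canonical≡ : canonical u ≡ canonical v
      canonical≡ = trans (lookup-index (canonical-∈ u)) (trans (cong member class≡) (sym (lookup-index (canonical-∈ v))))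

module _ {n m} {G : Graph n} {H : Graph m} (f : Fin n → Fin m)
  (edge : ∀ {u v} → adj G u v ≡ true → f u ≡ f v ⊎ adj H (f u) (f v) ≡ true) where

  reach-map : ∀ k {x y} → T (reach G k x y) → T (reach H k (f x) (f y))
  reach-map zero    {x} {y} x≡y = fromWitness (cong f (toWitness {a? = x ≟ᶠ y} x≡y))
  reach-map (suc k) {x} {y} r with T-∨ .to r
  ... | inj₁ r' = T-∨ .from (inj₁ (reach-map k r'))
  ... | inj₂ step with any-allFin _ .to step
  ...   | z , xz-step with T-∧ .to xz-step
  ...     | xz , zy with edge (T-≡ .to xz)
  ...       | inj₁ fx≡fz = T-∨ .from (inj₁ (subst (λ i → T (reach H k i (f y))) (sym fx≡fz) (reach-map k zy)))
  ...       | inj₂ fxfz  = T-∨ .from (inj₂ (any-allFin _ .from (f z , T-∧ .from (T-≡ .from fxfz , reach-map k zy))))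

  connected-image : (∀ i → ∃ λ u → f u ≡ i) → Connected G → Connected H
  connected-image surjective connected i j with surjective i | surjective j
  ... | u , refl | v , refl with connected u v
  ...   | k , r = k , T-≡ .to (reach-map k (T-≡ .from r))

module TwinQuotient {n} (G : Graph n) where
  open FinQuotient (twins-isDecEquivalence G) public

  quotient : Graph m
  quotient = record
    { adj   = λ i j → adj G (member i) (member j)
    ; sym   = λ i j → adj-sym G (member i) (member j)
    ; irref = λ i → irref G (member i)
    }

  twins-member : ∀ u → Twins G u (member (class u))
  twins-member u = class≡⇒≈ (sym (class-member (class u)))

  cross-adj : ∀ u v → class u ≢ class v → adj G u v ≡ adj quotient (class u) (class v)
  cross-adj u v cu≢cv = begin
    adj G u v   ≡⟨ twins-member u v (apart refl refl ∘ sym) (apart (class-member _) refl ∘ sym) ⟩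
    adj G u' v  ≡⟨ twins-swap G (twins-member v) (apart (class-member _) refl) (apart (class-member _) (class-member _)) ⟩
    adj G u' v' ∎
    where
    open ≡-Reasoning
    u' = member (class u)
    v' = member (class v)
    apart : ∀ {a b} → class a ≡ class u → class b ≡ class v → a ≢ b
    apart ca cb a≡b = cu≢cv (trans (sym ca) (trans (cong class a≡b) cb))

  adj-within-class : ∀ {i x y x' y'} → class x ≡ i → class y ≡ i → class x' ≡ i → class y' ≡ i →
    x ≢ y → x' ≢ y' → adj G x y ≡ adj G x' y'
  adj-within-class {i} cx cy cx' cy' = twins-adj G (twins cx cx') (twins cy cy') (twins cx cy')
    where
    twins : ∀ {a b} → class a ≡ i → class b ≡ i → Twins G a b
    twins ca cb = class≡⇒≈ (trans ca (sym cb))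

  quotient-connected : Connected G → Connected quotient
  quotient-connected = connected-image class edge (λ i → member i , class-member i)
    where
    edge : ∀ {u v} → adj G u v ≡ true → class u ≡ class v ⊎ adj quotient (class u) (class v) ≡ true
    edge {u} {v} uv with class u ≟ᶠ class v
    ... | yes cu≡cv = inj₁ cu≡cv
    ... | no cu≢cv  = inj₂ (trans (sym (cross-adj u v cu≢cv)) uv)

  quotient-isBlowup : (∀ u → ∃ λ v → v ≢ u × Twins G u v) → IsBlowupOf G quotient
  quotient-isBlowup hasTwin = class , classes , homogeneous , cross-adj
    where
    classes : ∀ i → Σ (Fin n) λ u → Σ (Fin n) λ v → u ≢ v × class u ≡ i × class v ≡ i
    classes i with hasTwin (member i)
    ... | v , v≢u , uv = member i , v , (v≢u ∘ sym) , class-member i , trans (sym (≈⇒class≡ uv)) (class-member i)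

    homogeneous : ∀ i → (∀ u v → class u ≡ i → class v ≡ i → u ≢ v → adj G u v ≡ true)
                      ⊎ (∀ u v → class u ≡ i → class v ≡ i → adj G u v ≡ false)
    homogeneous i with classes i
    ... | u₀ , v₀ , u₀≢v₀ , cu₀ , cv₀ with adj G u₀ v₀ in u₀v₀
    ...   | true  = inj₁ λ u v cu cv u≢v → trans (adj-within-class cu cv cu₀ cv₀ u≢v u₀≢v₀) u₀v₀
    ...   | false = inj₂ λ u v cu cv → case u ≟ᶠ v of λ where
      (yes refl) → irref G u
      (no u≢v)   → trans (adj-within-class cu cv cu₀ cv₀ u≢v u₀≢v₀) u₀v₀

theorem2p8 : ∀ (n : ℕ) (G : Graph n) → n ≥ 2 → Connected G →
    FracTruncDimIs G 1 ((+ n) / 2) ⇔ InBlowupFamily G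
theorem2p8 n G _ connected = mk⇔
  (λ dim → m , quotient , quotient-connected connected , quotient-isBlowup (dim≡n/2⇒twins G dim))
  (λ (_ , H , _ , blowup) → blowup⇒dim≡n/2 {G = G} {H} blowup)
  where open TwinQuotient G
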